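{- Let $H$ be a graph and let $l$ be an intersecting supermodular weakly subadditive integer-valued function on subsets of $V(H)$. If $H$ is minimally $l$-partition-connected and $S\subseteq V(H)$, then $$\Theta_l(H\setminus S)=\sum_{v\in S}\big(d_H(v)-l(v)\big)+l(H)-e_H(S).$$
   Context: Graphs are finite, loopless, and may have multiple edges. $l(\emptyset)=0$, $l(H)=l(V(H))$, $l(v)=l(\{v\})$. $l$ is intersecting supermodular if $l(A\cap B)+l(A\cup B)\ge l(A)+l(B)$ whenever $A\cap B\neq\emptyset$; weakly subadditive if $\sum_{v\in A}l(v)\ge l(A)$ for all $A$. For a partition $P$ of $V(K)$, $e_K(P)$ is the number of edges joining different parts; $K$ is $l$-partition-connected if $e_K(P)\ge\sum_{A\in P}l(A)-l(V(K))$ for every partition $P$, and minimally so if no edge can be deleted preserving this. The $l$-partition-connected components of $K$ are the maximal $Y$ with $K[Y]$ $l$-partition-connected (they partition $V(K)$), and $\Theta_l(K)=\sum_{A\in P}l(A)-e_K(P)$ for this partition; $\Theta_l$ of the graph with no vertices is $0$. $H\setminus S$ deletes the vertices of $S$; $e_H(S)$ is the number of edges with both ends in $S$. -}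

module Defs where

open import Data.Bool using (Bool; true; false; _∧_; _∨_; not; if_then_else_)
open import Data.Nat using (ℕ; zero; suc)
open import Data.Integer using (ℤ; +_; _+_; _-_; _≥_)
open import Data.Fin using (Fin)
open import Data.Fin.Subset using (Subset; ⊥; ⊤; ⁅_⁆; _∩_; _∪_; _─_; ⋃; Nonempty; Empty; _⊆_)
open import Data.List using (List; []; _∷_; map; foldr; allFin; removeAt; length)
open import Data.Bool.ListAction using (any)
open import Data.List.Relation.Unary.All using (All)
open import Data.List.Relation.Unary.AllPairs using (AllPairs)
open import Data.Vec using (lookup)
open import Data.Product using (_×_; _,_; proj₁; proj₂)
open import Relation.Binary.PropositionalEquality using (_≡_; _≢_)

Edges : ℕ → Set
Edges n = List (Fin n × Fin n)

Loopless : ∀ {n} → Edges n → Set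
Loopless E = All (λ e → proj₁ e ≢ proj₂ e) E

_∈ᵇ_ : ∀ {n} → Fin n → Subset n → Bool
v ∈ᵇ A = lookup A v

countᵇ : ∀ {A : Set} → (A → Bool) → List A → ℕ
countᵇ p [] = 0
countᵇ p (x ∷ xs) = if p x then suc (countᵇ p xs) else countᵇ p xs

sumℤ : List ℤ → ℤ
sumℤ = foldr _+_ (+ 0)

sumOver : ∀ {n} → Subset n → (Fin n → ℤ) → ℤ
sumOver {n} A f = sumℤ (map (λ v → if v ∈ᵇ A then f v else + 0) (allFin n))

SetFn : ℕ → Set
SetFn n = Subset n → ℤ

IntersectingSupermodular : ∀ {n} → SetFn n → Set
IntersectingSupermodular l =
  ∀ A B → Nonempty (A ∩ B) → l (A ∩ B) + l (A ∪ B) ≥ l A + l B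

WeaklySubadditive : ∀ {n} → SetFn n → Set
WeaklySubadditive l = ∀ A → sumOver A (λ v → l ⁅ v ⁆) ≥ l A

IsPartition : ∀ {n} → Subset n → List (Subset n) → Set
IsPartition Y P = All Nonempty P × AllPairs (λ A B → Empty (A ∩ B)) P × ⋃ P ≡ Y

samePart : ∀ {n} → List (Subset n) → Fin n → Fin n → Bool
samePart P u v = any (λ A → (u ∈ᵇ A) ∧ (v ∈ᵇ A)) P

crossEdges : ∀ {n} → Edges n → Subset n → List (Subset n) → ℕ
crossEdges E Y P =
  countᵇ (λ e → (proj₁ e ∈ᵇ Y) ∧ (proj₂ e ∈ᵇ Y) ∧ not (samePart P (proj₁ e) (proj₂ e))) E

sumL : ∀ {n} → SetFn n → List (Subset n) → ℤ
sumL l P = sumℤ (map l P)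

PartitionConnected : ∀ {n} → SetFn n → Edges n → Subset n → Set
PartitionConnected l E Y =
  ∀ P → IsPartition Y P → + crossEdges E Y P ≥ sumL l P - l Y

MinimallyPartitionConnected : ∀ {n} → SetFn n → Edges n → Set
MinimallyPartitionConnected l E =
  PartitionConnected l E ⊤ ×
  (∀ (i : Fin (length E)) → PartitionConnected l (removeAt E i) ⊤ → Data.Empty.⊥)
  where import Data.Empty

IsComponentPartition : ∀ {n} → SetFn n → Edges n → Subset n → List (Subset n) → Set
IsComponentPartition l E Y P =
  IsPartition Y P ×
  All (λ A → PartitionConnected l E A ×
             (∀ Z → Z ⊆ Y → A ⊆ Z → PartitionConnected l E Z → Z ≡ A)) P

-- Θ_l(H[Y]) computed from its component partition P
Θ : ∀ {n} → SetFn n → Edges n → Subset n → List (Subset n) → ℤ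
Θ l E Y P = sumL l P - + crossEdges E Y P

degree : ∀ {n} → Edges n → Fin n → ℕ
degree E v = countᵇ (λ e → (proj₁ e ∈ᵇ ⁅ v ⁆) ∨ (proj₂ e ∈ᵇ ⁅ v ⁆)) E

eIn : ∀ {n} → Edges n → Subset n → ℕ
eIn E S = countᵇ (λ e → (proj₁ e ∈ᵇ S) ∧ (proj₂ e ∈ᵇ S)) E

-- Let h(X) = Σ_{v∈X} l(v) − l(X) − e_H(X).  For a partition Q of Y, a double count of edges gives
-- e_{H[Y]}(Q) − (Σ_{A∈Q} l(A) − l(Y)) = Σ_{A∈Q} h(A) − h(Y), so H[Y] is l-partition-connected iff
-- h(Y) ≤ Σ_{A∈Q} h(A) for every partition Q of Y; as h vanishes on singletons this forces h(Y) ≤ 0.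
-- Minimality forces h ≥ 0: a smallest X with h(X) < 0 spans an edge (weak subadditivity), and that edge
-- is redundant, since for a partition separating its ends, absorbing X into the parts it meets (h is
-- intersecting submodular and nonnegative on the proper subsets X ∩ A) leaves the cut condition with slack.
-- So h vanishes on V(H) and on every component of H ∖ S, whence Θ_l(H ∖ S) = Σ_{v∉S} l(v) − e_H(V ∖ S);
-- the right-hand side reduces to the same value through Σ_{v∈S} d_H(v) = e_H(V) + e_H(S) − e_H(V ∖ S).

module Submission where

open import Defs
open import Algebra.Properties.CommutativeSemigroup using (x∙yz≈y∙xz)
open import Data.Bool using (Bool; true; false; _∧_; _∨_; not; if_then_else_)
open import Data.Bool.Properties using (∧-conicalˡ; ∧-conicalʳ; ∨-conicalˡ; ∨-conicalʳ)
open import Data.Empty using (⊥-elim)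
open import Data.Fin using (Fin; zero; suc)
open import Data.Fin.Subset
  using (Subset; ⊥; ⊤; ⁅_⁆; ∁; _∩_; _∪_; ⋃; Empty; Nonempty; _∈_; _⊆_; ∣_∣)
open import Data.Fin.Subset.Properties
  using ( _∈?_; nonempty?; ∉⊥; x∈⁅x⁆; x∈⁅y⁆⇒x≡y; x∈p∩q⁺; x∈p∩q⁻; x∈p∪q⁺; x∈p∪q⁻
        ; p⊆p∪q; p∩q⊆p; ⊆-antisym; p⊂q⇒∣p∣<∣q∣; Empty-unique
        ; ∪-assoc; ∪-comm; ∩-comm; ∪-zeroʳ; ∩-inverseʳ; p∪∁p≡⊤ )
open import Data.Integer using (ℤ; +_; _+_; _-_; _≤_; _<_; +≤+; 0ℤ; 1ℤ)
import Data.Integer.Properties as ℤ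
open import Data.Integer.Tactic.RingSolver using (solve-∀)
open import Data.List using (List; []; _∷_; map; filter; allFin; removeAt; length; lookup)
import Data.List.Properties as List
open import Data.List.Membership.Propositional using () renaming (_∈_ to _∈ₗ_)
open import Data.List.Membership.Propositional.Properties
  using (∈-allFin; ∈-filter⁺; ∈-filter⁻; ∈-map⁺; ∈-map⁻)
open import Data.List.Relation.Unary.All using (All; []; _∷_)
import Data.List.Relation.Unary.All as All
import Data.List.Relation.Unary.All.Properties as All
open import Data.List.Relation.Unary.AllPairs using (AllPairs; []; _∷_)
import Data.List.Relation.Unary.AllPairs as AllPairs
import Data.List.Relation.Unary.AllPairs.Properties as AllPairs
open import Data.List.Relation.Unary.Any using (here; there)
open import Data.List.Relation.Unary.Unique.Propositional.Properties using (allFin⁺)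
open import Data.Nat as ℕ using (ℕ; zero; suc)
open import Data.Nat.Induction using (<-rec)
open import Data.Product using (_×_; _,_; proj₁; proj₂; ∃; ∃-syntax)
open import Data.Sum using (_⊎_; inj₁; inj₂)
open import Data.Vec using (_∷_)
open import Data.Vec.Properties using (lookup-zipWith; lookup-map; lookup-replicate; []=⇒lookup; lookup⇒[]=)
open import Function using (_∘_; id)
open import Relation.Binary.PropositionalEquality
open import Relation.Nullary using (¬_; yes; no)

∈ᵇ-∩ : ∀ {n} (A B : Subset n) v → v ∈ᵇ (A ∩ B) ≡ v ∈ᵇ A ∧ v ∈ᵇ B
∈ᵇ-∩ A B v = lookup-zipWith _∧_ v A B

∈ᵇ-∪ : ∀ {n} (A B : Subset n) v → v ∈ᵇ (A ∪ B) ≡ v ∈ᵇ A ∨ v ∈ᵇ B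
∈ᵇ-∪ A B v = lookup-zipWith _∨_ v A B

∈ᵇ-∁ : ∀ {n} (A : Subset n) v → v ∈ᵇ ∁ A ≡ not (v ∈ᵇ A)
∈ᵇ-∁ A v = lookup-map v not A

∈ᵇ-⊤ : ∀ {n} (v : Fin n) → v ∈ᵇ ⊤ ≡ true
∈ᵇ-⊤ v = lookup-replicate v true

∈ᵇ-⊥ : ∀ {n} (v : Fin n) → v ∈ᵇ ⊥ ≡ false
∈ᵇ-⊥ v = lookup-replicate v false

∈ᵇ⇒∈ : ∀ {n} {v : Fin n} {A} → v ∈ᵇ A ≡ true → v ∈ A
∈ᵇ⇒∈ {v = v} {A} = lookup⇒[]= v A

∈⇒∈ᵇ : ∀ {n} {v : Fin n} {A} → v ∈ A → v ∈ᵇ A ≡ true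
∈⇒∈ᵇ = []=⇒lookup

∈ᵇ-⁅⁆-sym : ∀ {n} (u v : Fin n) → u ∈ᵇ ⁅ v ⁆ ≡ v ∈ᵇ ⁅ u ⁆
∈ᵇ-⁅⁆-sym zero    zero    = refl
∈ᵇ-⁅⁆-sym zero    (suc v) = sym (∈ᵇ-⊥ v)
∈ᵇ-⁅⁆-sym (suc u) zero    = ∈ᵇ-⊥ u
∈ᵇ-⁅⁆-sym (suc u) (suc v) = ∈ᵇ-⁅⁆-sym u v

Disjoint : ∀ {n} → Subset n → Subset n → Set
Disjoint A B = Empty (A ∩ B)

disjoint⇒∉ᵇ : ∀ {n} {A B : Subset n} {v} → Disjoint A B → v ∈ᵇ A ≡ true → v ∈ᵇ B ≡ false
disjoint⇒∉ᵇ {B = B} {v} A∩B=∅ v∈A with v ∈ᵇ B in v∈B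
... | false = refl
... | true  = ⊥-elim (A∩B=∅ (v , x∈p∩q⁺ (∈ᵇ⇒∈ v∈A , ∈ᵇ⇒∈ v∈B)))

module _ {n : ℕ} where

  disjoint-sym : {A B : Subset n} → Disjoint A B → Disjoint B A
  disjoint-sym {A} {B} = subst Empty (∩-comm A B)

  disjoint-∪ : {D A B : Subset n} → Disjoint D A → Disjoint D B → Disjoint D (A ∪ B)
  disjoint-∪ {D} {A} {B} D∩A=∅ D∩B=∅ (x , x∈D∩A∪B) with x∈p∩q⁻ D (A ∪ B) x∈D∩A∪B
  ... | x∈D , x∈A∪B with x∈p∪q⁻ A B x∈A∪B
  ...   | inj₁ x∈A = D∩A=∅ (x , x∈p∩q⁺ (x∈D , x∈A))
  ...   | inj₂ x∈B = D∩B=∅ (x , x∈p∩q⁺ (x∈D , x∈B))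

  ∪-∩-disjoint : (B : Subset n) {A C : Subset n} → Disjoint A C → (B ∪ A) ∩ C ≡ B ∩ C
  ∪-∩-disjoint B {A} {C} A∩C=∅ = ⊆-antisym to from
    where
    to : (B ∪ A) ∩ C ⊆ B ∩ C
    to x∈ with x∈p∩q⁻ (B ∪ A) C x∈
    ... | x∈B∪A , x∈C with x∈p∪q⁻ B A x∈B∪A
    ...   | inj₁ x∈B = x∈p∩q⁺ (x∈B , x∈C)
    ...   | inj₂ x∈A = ⊥-elim (A∩C=∅ (_ , x∈p∩q⁺ (x∈A , x∈C)))
    from : B ∩ C ⊆ (B ∪ A) ∩ C
    from x∈ with x∈p∩q⁻ B C x∈
    ... | x∈B , x∈C = x∈p∩q⁺ (p⊆p∪q A x∈B , x∈C)

  ∪-left-comm : (A B C : Subset n) → A ∪ (B ∪ C) ≡ B ∪ (A ∪ C)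
  ∪-left-comm A B C = trans (sym (∪-assoc A B C)) (trans (cong (_∪ C) (∪-comm A B)) (∪-assoc B A C))

disjoint-⋃ : ∀ {n} {A : Subset n} {Q} → All (Disjoint A) Q → Disjoint A (⋃ Q)
disjoint-⋃ {A = A} [] (x , x∈A∩⊥) = ∉⊥ (proj₂ (x∈p∩q⁻ A ⊥ x∈A∩⊥))
disjoint-⋃ {A = A} {B ∷ Q} (A∩B=∅ ∷ rest) (x , x∈A∩⋃) with x∈p∩q⁻ A (B ∪ ⋃ Q) x∈A∩⋃
... | x∈A , x∈B∪⋃ with x∈p∪q⁻ B (⋃ Q) x∈B∪⋃
...   | inj₁ x∈B = A∩B=∅ (x , x∈p∩q⁺ (x∈A , x∈B))
...   | inj₂ x∈⋃ = disjoint-⋃ rest (x , x∈p∩q⁺ (x∈A , x∈⋃))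

⁅⁆-disjoint : ∀ {n} {u w : Fin n} → u ≢ w → Disjoint ⁅ u ⁆ ⁅ w ⁆
⁅⁆-disjoint {u = u} {w} u≢w (x , x∈⁅u⁆∩⁅w⁆) with x∈p∩q⁻ ⁅ u ⁆ ⁅ w ⁆ x∈⁅u⁆∩⁅w⁆
... | x∈⁅u⁆ , x∈⁅w⁆ = u≢w (trans (sym (x∈⁅y⁆⇒x≡y u x∈⁅u⁆)) (x∈⁅y⁆⇒x≡y w x∈⁅w⁆))

∈⋃⁺ : ∀ {n} {x : Fin n} {A Q} → x ∈ A → A ∈ₗ Q → x ∈ ⋃ Q
∈⋃⁺ x∈A (here refl)  = x∈p∪q⁺ (inj₁ x∈A)
∈⋃⁺ x∈A (there A∈Q) = x∈p∪q⁺ (inj₂ (∈⋃⁺ x∈A A∈Q))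

∈⋃⁻ : ∀ {n} {x : Fin n} (Q : List (Subset n)) → x ∈ ⋃ Q → ∃ λ A → A ∈ₗ Q × x ∈ A
∈⋃⁻ []      x∈⊥   = ⊥-elim (∉⊥ x∈⊥)
∈⋃⁻ (A ∷ Q) x∈A∪⋃ with x∈p∪q⁻ A (⋃ Q) x∈A∪⋃
... | inj₁ x∈A = A , here refl , x∈A
... | inj₂ x∈⋃ with ∈⋃⁻ Q x∈⋃
...   | B , B∈Q , x∈B = B , there B∈Q , x∈B

∣p∩q∣<∣p∣ : ∀ {n} {X A : Subset n} {v} → v ∈ᵇ X ≡ true → v ∈ᵇ A ≡ false → ∣ X ∩ A ∣ ℕ.< ∣ X ∣
∣p∩q∣<∣p∣ {X = X} {A} {v} v∈X v∉A = p⊂q⇒∣p∣<∣q∣ (p∩q⊆p X A , v , ∈ᵇ⇒∈ v∈X , v∉X∩A)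
  where
  v∉X∩A : ¬ v ∈ X ∩ A
  v∉X∩A v∈X∩A with () ← trans (sym (∈⇒∈ᵇ (proj₂ (x∈p∩q⁻ X A v∈X∩A)))) v∉A

samePart⇒∈⋃ : ∀ {n} (Q : List (Subset n)) u w → samePart Q u w ≡ true →
  u ∈ᵇ ⋃ Q ≡ true × w ∈ᵇ ⋃ Q ≡ true
samePart⇒∈⋃ (A ∷ Q) u w same rewrite ∈ᵇ-∪ A (⋃ Q) u | ∈ᵇ-∪ A (⋃ Q) w
  with u ∈ᵇ A | w ∈ᵇ A | samePart⇒∈⋃ Q u w
... | true  | true  | _  = refl , refl
... | true  | false | IH = refl , proj₂ (IH same)
... | false | true  | IH = proj₁ (IH same) , refl
... | false | false | IH = IH same

samePart≡false : ∀ {n} (P : List (Subset n)) u w → samePart P u w ≡ false →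
  All (λ A → (u ∈ᵇ A ∧ w ∈ᵇ A) ≡ false) P
samePart≡false []      u w _         = []
samePart≡false (A ∷ P) u w different =
  ∨-conicalˡ _ _ different ∷ samePart≡false P u w (∨-conicalʳ _ _ different)

singletons : ∀ {n} → Subset n → List (Subset n)
singletons {n} Y = map ⁅_⁆ (filter (_∈? Y) (allFin n))

singletons-isPartition : ∀ {n} (Y : Subset n) → IsPartition Y (singletons Y)
singletons-isPartition {n} Y =
  All.map⁺ (All.universal (λ v → v , x∈⁅x⁆ v) _) ,
  AllPairs.map⁺ (AllPairs.map ⁅⁆-disjoint (AllPairs.filter⁺ (_∈? Y) (allFin⁺ n))) ,
  ⊆-antisym ⋃⊆Y Y⊆⋃
  where
  ⋃⊆Y : ⋃ (singletons Y) ⊆ Y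
  ⋃⊆Y x∈⋃ with ∈⋃⁻ (singletons Y) x∈⋃
  ... | A , A∈singletons , x∈A with ∈-map⁻ ⁅_⁆ A∈singletons
  ...   | v , v∈filter , refl =
    subst (_∈ Y) (sym (x∈⁅y⁆⇒x≡y v x∈A)) (proj₂ (∈-filter⁻ (_∈? Y) {xs = allFin n} v∈filter))
  Y⊆⋃ : Y ⊆ ⋃ (singletons Y)
  Y⊆⋃ {x} x∈Y = ∈⋃⁺ (x∈⁅x⁆ x) (∈-map⁺ ⁅_⁆ (∈-filter⁺ (_∈? Y) (∈-allFin x) x∈Y))

module _ {n : ℕ} where

  absorb : Subset n → List (Subset n) → List (Subset n)
  absorb B []      = B ∷ []
  absorb B (A ∷ P) with nonempty? (B ∩ A)
  ... | yes _ = absorb (B ∪ A) P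
  ... | no  _ = A ∷ absorb B P

  absorb-nonempty : ∀ {B} P → Nonempty B → All Nonempty P → All Nonempty (absorb B P)
  absorb-nonempty []      B≠∅ []            = B≠∅ ∷ []
  absorb-nonempty {B} (A ∷ P) B≠∅ (A≠∅ ∷ P≠∅) with nonempty? (B ∩ A)
  ... | yes _ = absorb-nonempty P (proj₁ B≠∅ , p⊆p∪q A (proj₂ B≠∅)) P≠∅
  ... | no  _ = A≠∅ ∷ absorb-nonempty P B≠∅ P≠∅

  absorb-disjoint-from : ∀ {D B} P → Disjoint D B → All (Disjoint D) P → All (Disjoint D) (absorb B P)
  absorb-disjoint-from []      D∩B=∅ []             = D∩B=∅ ∷ []
  absorb-disjoint-from {B = B} (A ∷ P) D∩B=∅ (D∩A=∅ ∷ D∩P=∅) with nonempty? (B ∩ A)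
  ... | yes _ = absorb-disjoint-from P (disjoint-∪ D∩B=∅ D∩A=∅) D∩P=∅
  ... | no  _ = D∩A=∅ ∷ absorb-disjoint-from P D∩B=∅ D∩P=∅

  absorb-disjoint : ∀ {B} P → AllPairs Disjoint P → AllPairs Disjoint (absorb B P)
  absorb-disjoint []      []                    = [] ∷ []
  absorb-disjoint {B} (A ∷ P) (A∩P=∅ ∷ disjoint) with nonempty? (B ∩ A)
  ... | yes _   = absorb-disjoint P disjoint
  ... | no  B∩A=∅ = absorb-disjoint-from P (disjoint-sym B∩A=∅) A∩P=∅ ∷ absorb-disjoint P disjoint

  ⋃-absorb : ∀ B P → ⋃ (absorb B P) ≡ B ∪ ⋃ P
  ⋃-absorb B []      = refl
  ⋃-absorb B (A ∷ P) with nonempty? (B ∩ A)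
  ... | yes _ = trans (⋃-absorb (B ∪ A) P) (∪-assoc B A (⋃ P))
  ... | no  _ = trans (cong (A ∪_) (⋃-absorb B P)) (∪-left-comm A B (⋃ P))

  absorb-isPartition : ∀ {B Y P} → Nonempty B → IsPartition Y P → IsPartition (B ∪ Y) (absorb B P)
  absorb-isPartition {B} {P = P} B≠∅ (P≠∅ , disjoint , refl) =
    absorb-nonempty P B≠∅ P≠∅ , absorb-disjoint P disjoint , ⋃-absorb B P

𝟙 : Bool → ℤ
𝟙 b = if b then 1ℤ else 0ℤ

∑ : {X : Set} → List X → (X → ℤ) → ℤ
∑ xs f = sumℤ (map f xs)

module _ {X : Set} where

  ∑-cong : (xs : List X) {f g : X → ℤ} → (∀ x → f x ≡ g x) → ∑ xs f ≡ ∑ xs g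
  ∑-cong []       f≡g = refl
  ∑-cong (x ∷ xs) f≡g = cong₂ _+_ (f≡g x) (∑-cong xs f≡g)

  ∑-congᴬ : {xs : List X} {f g : X → ℤ} → All (λ x → f x ≡ g x) xs → ∑ xs f ≡ ∑ xs g
  ∑-congᴬ []           = refl
  ∑-congᴬ (fx≡gx ∷ eq) = cong₂ _+_ fx≡gx (∑-congᴬ eq)

  ∑-zero : (xs : List X) → ∑ xs (λ _ → 0ℤ) ≡ 0ℤ
  ∑-zero []       = refl
  ∑-zero (x ∷ xs) = trans (ℤ.+-identityˡ _) (∑-zero xs)

  ∑-zeroᴬ : {xs : List X} {f : X → ℤ} → All (λ x → f x ≡ 0ℤ) xs → ∑ xs f ≡ 0ℤ
  ∑-zeroᴬ {xs} fx≡0 = trans (∑-congᴬ fx≡0) (∑-zero xs)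

  ∑-+ : (xs : List X) (f g : X → ℤ) → ∑ xs (λ x → f x + g x) ≡ ∑ xs f + ∑ xs g
  ∑-+ []       f g = refl
  ∑-+ (x ∷ xs) f g = trans (cong (_+_ (f x + g x)) (∑-+ xs f g)) (interchange (f x) (g x) _ _)
    where interchange : ∀ a b c d → a + b + (c + d) ≡ a + c + (b + d)
          interchange = solve-∀

  ∑-sub : (xs : List X) (f g : X → ℤ) → ∑ xs (λ x → f x - g x) ≡ ∑ xs f - ∑ xs g
  ∑-sub []       f g = refl
  ∑-sub (x ∷ xs) f g = trans (cong (_+_ (f x - g x)) (∑-sub xs f g)) (interchange (f x) (g x) _ _)
    where interchange : ∀ a b c d → a - b + (c - d) ≡ a + c - (b + d)
          interchange = solve-∀

  ∑-mono-≤ : (xs : List X) {f g : X → ℤ} → (∀ x → f x ≤ g x) → ∑ xs f ≤ ∑ xs g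
  ∑-mono-≤ []       f≤g = ℤ.≤-refl
  ∑-mono-≤ (x ∷ xs) f≤g = ℤ.+-mono-≤ (f≤g x) (∑-mono-≤ xs f≤g)

  ∑-if : (b : Bool) (xs : List X) (f : X → ℤ) →
    (if b then ∑ xs f else 0ℤ) ≡ ∑ xs (λ x → if b then f x else 0ℤ)
  ∑-if true  xs f = refl
  ∑-if false xs f = sym (∑-zero xs)

  countᵇ-∑ : (p : X → Bool) (xs : List X) → + countᵇ p xs ≡ ∑ xs (𝟙 ∘ p)
  countᵇ-∑ p []       = refl
  countᵇ-∑ p (x ∷ xs) with p x
  ... | true  = cong (_+_ 1ℤ) (countᵇ-∑ p xs)
  ... | false = trans (countᵇ-∑ p xs) (sym (ℤ.+-identityˡ _))

  countᵇ-removeAt : (p : X → Bool) (xs : List X) (i : Fin (length xs)) →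
    + countᵇ p xs ≡ 𝟙 (p (lookup xs i)) + + countᵇ p (removeAt xs i)
  countᵇ-removeAt p (x ∷ xs) zero with p x
  ... | true  = refl
  ... | false = refl
  countᵇ-removeAt p (x ∷ xs) (suc i) with p x
  ... | true  = trans (cong (_+_ 1ℤ) (countᵇ-removeAt p xs i))
                      (x∙yz≈y∙xz ℤ.+-commutativeSemigroup 1ℤ (𝟙 (p (lookup xs i))) (+ countᵇ p (removeAt xs i)))
  ... | false = countᵇ-removeAt p xs i

  countᵇ≡0⊎∃ : (p : X → Bool) (xs : List X) → countᵇ p xs ≡ 0 ⊎ ∃[ i ] p (lookup xs i) ≡ true
  countᵇ≡0⊎∃ p []       = inj₁ refl
  countᵇ≡0⊎∃ p (x ∷ xs) with p x in px
  ... | true  = inj₂ (zero , px)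
  ... | false with countᵇ≡0⊎∃ p xs
  ...   | inj₁ none       = inj₁ none
  ...   | inj₂ (i , pxᵢ) = inj₂ (suc i , pxᵢ)

∑-swap : {X Y : Set} (xs : List X) (ys : List Y) (f : X → Y → ℤ) →
  ∑ xs (λ x → ∑ ys (f x)) ≡ ∑ ys (λ y → ∑ xs (λ x → f x y))
∑-swap []       ys f = sym (∑-zero ys)
∑-swap (x ∷ xs) ys f =
  trans (cong (_+_ (∑ ys (f x))) (∑-swap xs ys f)) (sym (∑-+ ys (f x) (λ y → ∑ xs (λ x → f x y))))

𝟙-∨ : ∀ a b → (a ≡ true → b ≡ false) → 𝟙 (a ∨ b) ≡ 𝟙 a + 𝟙 b
𝟙-∨ true  b exclusive rewrite exclusive refl = refl
𝟙-∨ false b exclusive = sym (ℤ.+-identityˡ (𝟙 b))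

𝟙-∧-∧-not : ∀ a b s → (s ≡ true → (a ∧ b) ≡ true) → 𝟙 (a ∧ b ∧ not s) ≡ 𝟙 (a ∧ b) - 𝟙 s
𝟙-∧-∧-not true  true  true  _   = refl
𝟙-∧-∧-not true  true  false _   = refl
𝟙-∧-∧-not true  false false _   = refl
𝟙-∧-∧-not false b     false _   = refl
𝟙-∧-∧-not true  false true  s⇒ab with () ← s⇒ab refl
𝟙-∧-∧-not false b     true  s⇒ab with () ← s⇒ab refl

𝟙-∧-supermodular : ∀ a b c d →
  𝟙 (a ∧ b) + 𝟙 (c ∧ d) ≤ 𝟙 ((a ∧ c) ∧ (b ∧ d)) + 𝟙 ((a ∨ c) ∧ (b ∨ d))
𝟙-∧-supermodular true  true  true  true  = ℤ.≤-refl
𝟙-∧-supermodular true  true  true  false = ℤ.≤-refl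
𝟙-∧-supermodular true  true  false true  = ℤ.≤-refl
𝟙-∧-supermodular true  true  false false = ℤ.≤-refl
𝟙-∧-supermodular true  false true  true  = ℤ.≤-refl
𝟙-∧-supermodular true  false true  false = ℤ.≤-refl
𝟙-∧-supermodular true  false false true  = +≤+ ℕ.z≤n
𝟙-∧-supermodular true  false false false = ℤ.≤-refl
𝟙-∧-supermodular false true  true  true  = ℤ.≤-refl
𝟙-∧-supermodular false true  true  false = +≤+ ℕ.z≤n
𝟙-∧-supermodular false true  false true  = ℤ.≤-refl
𝟙-∧-supermodular false true  false false = ℤ.≤-refl
𝟙-∧-supermodular false false true  true  = ℤ.≤-refl
𝟙-∧-supermodular false false true  false = ℤ.≤-refl
𝟙-∧-supermodular false false false true  = ℤ.≤-refl
𝟙-∧-supermodular false false false false = ℤ.≤-refl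

∑-samePart : ∀ {n} {Q : List (Subset n)} → AllPairs Disjoint Q → ∀ u w →
  ∑ Q (λ A → 𝟙 (u ∈ᵇ A ∧ w ∈ᵇ A)) ≡ 𝟙 (samePart Q u w)
∑-samePart []                                u w = refl
∑-samePart {Q = A ∷ Q} (A∩Q=∅ ∷ disjoint) u w =
  trans (cong (_+_ (𝟙 (u ∈ᵇ A ∧ w ∈ᵇ A))) (∑-samePart disjoint u w)) (sym (𝟙-∨ _ _ exclusive))
  where
  exclusive : (u ∈ᵇ A ∧ w ∈ᵇ A) ≡ true → samePart Q u w ≡ false
  exclusive u,w∈A with samePart Q u w in same
  ... | false = refl
  ... | true  with () ← trans (sym (proj₁ (samePart⇒∈⋃ Q u w same)))
                              (disjoint⇒∉ᵇ (disjoint-⋃ A∩Q=∅) (∧-conicalˡ _ _ u,w∈A))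

module _ {n : ℕ} where

  sumOver-∷ : ∀ b (A : Subset n) (f : Fin (suc n) → ℤ) →
    sumOver (b ∷ A) f ≡ (if b then f zero else 0ℤ) + sumOver A (f ∘ suc)
  sumOver-∷ b A f = cong (λ xs → (if b then f zero else 0ℤ) + sumℤ xs)
    (trans (List.map-tabulate suc (λ v → if v ∈ᵇ (b ∷ A) then f v else 0ℤ))
           (sym (List.map-tabulate id (λ v → if v ∈ᵇ A then f (suc v) else 0ℤ))))

  sumOver-⊥ : (f : Fin n → ℤ) → sumOver ⊥ f ≡ 0ℤ
  sumOver-⊥ f = trans (∑-cong (allFin n) (λ v → cong (λ b → if b then f v else 0ℤ) (∈ᵇ-⊥ v)))
                      (∑-zero (allFin n))

  sumOver-sub : (A : Subset n) (f g : Fin n → ℤ) →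
    sumOver A (λ v → f v - g v) ≡ sumOver A f - sumOver A g
  sumOver-sub A f g = trans (∑-cong (allFin n) pointwise) (∑-sub (allFin n) _ _)
    where
    pointwise : ∀ v → (if v ∈ᵇ A then f v - g v else 0ℤ)
                    ≡ (if v ∈ᵇ A then f v else 0ℤ) - (if v ∈ᵇ A then g v else 0ℤ)
    pointwise v with v ∈ᵇ A
    ... | true  = refl
    ... | false = refl

  sumOver-modular : (A B : Subset n) (f : Fin n → ℤ) →
    sumOver (A ∩ B) f + sumOver (A ∪ B) f ≡ sumOver A f + sumOver B f
  sumOver-modular A B f = begin
    sumOver (A ∩ B) f + sumOver (A ∪ B) f  ≡⟨ ∑-+ (allFin n) _ _ ⟨
    ∑ (allFin n) (λ v → if∈ (A ∩ B) v + if∈ (A ∪ B) v)  ≡⟨ ∑-cong (allFin n) pointwise ⟩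
    ∑ (allFin n) (λ v → if∈ A v + if∈ B v)  ≡⟨ ∑-+ (allFin n) _ _ ⟩
    sumOver A f + sumOver B f  ∎
    where
    open ≡-Reasoning
    if∈ : Subset n → Fin n → ℤ
    if∈ X v = if v ∈ᵇ X then f v else 0ℤ
    pointwise : ∀ v → if∈ (A ∩ B) v + if∈ (A ∪ B) v ≡ if∈ A v + if∈ B v
    pointwise v rewrite ∈ᵇ-∩ A B v | ∈ᵇ-∪ A B v with v ∈ᵇ A | v ∈ᵇ B
    ... | true  | true  = refl
    ... | true  | false = ℤ.+-comm 0ℤ (f v)
    ... | false | true  = refl
    ... | false | false = refl

  sumOver-∪ : ∀ {A B : Subset n} (f : Fin n → ℤ) → Disjoint A B →
    sumOver (A ∪ B) f ≡ sumOver A f + sumOver B f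
  sumOver-∪ {A} {B} f A∩B=∅ = begin
    sumOver (A ∪ B) f                      ≡⟨ ℤ.+-identityˡ _ ⟨
    0ℤ + sumOver (A ∪ B) f                 ≡⟨ cong (λ s → s + sumOver (A ∪ B) f) A∩B-sum ⟨
    sumOver (A ∩ B) f + sumOver (A ∪ B) f  ≡⟨ sumOver-modular A B f ⟩
    sumOver A f + sumOver B f              ∎
    where
    open ≡-Reasoning
    A∩B-sum : sumOver (A ∩ B) f ≡ 0ℤ
    A∩B-sum = trans (cong (λ X → sumOver X f) (Empty-unique A∩B=∅)) (sumOver-⊥ f)

  sumOver-⋃ : (f : Fin n → ℤ) {Q : List (Subset n)} → AllPairs Disjoint Q →
    ∑ Q (λ A → sumOver A f) ≡ sumOver (⋃ Q) f
  sumOver-⋃ f []                 = sym (sumOver-⊥ f)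
  sumOver-⋃ f {A ∷ Q} (A∩Q=∅ ∷ disjoint) =
    trans (cong (_+_ (sumOver A f)) (sumOver-⋃ f disjoint)) (sym (sumOver-∪ f (disjoint-⋃ A∩Q=∅)))

  sumOver-∁ : (S : Subset n) (f : Fin n → ℤ) → sumOver ⊤ f ≡ sumOver S f + sumOver (∁ S) f
  sumOver-∁ S f = trans (cong (λ X → sumOver X f) (sym (p∪∁p≡⊤ S)))
    (sumOver-∪ f (λ { (x , x∈S∩∁S) → ∉⊥ (subst (x ∈_) (∩-inverseʳ S) x∈S∩∁S) }))

sumOver-⁅⁆ : ∀ {n} (u : Fin n) (f : Fin n → ℤ) → sumOver ⁅ u ⁆ f ≡ f u
sumOver-⁅⁆ {suc n} zero    f =
  trans (sumOver-∷ true ⊥ f) (trans (cong (_+_ (f zero)) (sumOver-⊥ (f ∘ suc))) (ℤ.+-identityʳ _))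
sumOver-⁅⁆ {suc n} (suc u) f =
  trans (sumOver-∷ false ⁅ u ⁆ f) (trans (ℤ.+-identityˡ _) (sumOver-⁅⁆ u (f ∘ suc)))

IntersectingSubmodular : ∀ {n} → SetFn n → Set
IntersectingSubmodular f = ∀ A B → Nonempty (A ∩ B) → f (A ∩ B) + f (A ∪ B) ≤ f A + f B

module _ {n : ℕ} where

  absorb-∑-≤ : ∀ {f : SetFn n} → IntersectingSubmodular f → ∀ B P →
    All (λ A → 0ℤ ≤ f (B ∩ A)) P → AllPairs Disjoint P → ∑ (absorb B P) f ≤ f B + ∑ P f
  absorb-∑-≤ sub B []      []        []                 = ℤ.≤-refl
  absorb-∑-≤ {f} sub B (A ∷ P) (0≤f[B∩A] ∷ 0≤f[B∩P]) (A∩P=∅ ∷ disjoint) with nonempty? (B ∩ A)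
  ... | yes B∩A≠∅ = begin
    ∑ (absorb (B ∪ A) P) f  ≤⟨ absorb-∑-≤ sub (B ∪ A) P 0≤f[B∪A∩P] disjoint ⟩
    f (B ∪ A) + ∑ P f       ≤⟨ ℤ.+-monoˡ-≤ (∑ P f) f[B∪A]≤ ⟩
    f B + f A + ∑ P f       ≡⟨ ℤ.+-assoc (f B) (f A) (∑ P f) ⟩
    f B + (f A + ∑ P f)     ∎
    where
    open ℤ.≤-Reasoning
    0≤f[B∪A∩P] : All (λ A′ → 0ℤ ≤ f ((B ∪ A) ∩ A′)) P
    0≤f[B∪A∩P] = All.zipWith (λ (A∩A′=∅ , 0≤f[B∩A′]) →
                   subst (λ X → 0ℤ ≤ f X) (sym (∪-∩-disjoint B A∩A′=∅)) 0≤f[B∩A′]) (A∩P=∅ , 0≤f[B∩P])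
    f[B∪A]≤ : f (B ∪ A) ≤ f B + f A
    f[B∪A]≤ = begin
      f (B ∪ A)              ≡⟨ ℤ.+-identityˡ (f (B ∪ A)) ⟨
      0ℤ + f (B ∪ A)         ≤⟨ ℤ.+-monoˡ-≤ (f (B ∪ A)) 0≤f[B∩A] ⟩
      f (B ∩ A) + f (B ∪ A)  ≤⟨ sub B A B∩A≠∅ ⟩
      f B + f A              ∎
  ... | no _ = begin
    f A + ∑ (absorb B P) f  ≤⟨ ℤ.+-monoʳ-≤ (f A) (absorb-∑-≤ sub B P 0≤f[B∩P] disjoint) ⟩
    f A + (f B + ∑ P f)     ≡⟨ x∙yz≈y∙xz ℤ.+-commutativeSemigroup (f A) (f B) (∑ P f) ⟩
    f B + (f A + ∑ P f)     ∎
    where open ℤ.≤-Reasoning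

endsIn : ∀ {n} → Subset n → Fin n × Fin n → Bool
endsIn X e = proj₁ e ∈ᵇ X ∧ proj₂ e ∈ᵇ X

module _ {n : ℕ} (E : Edges n) where

  eIn-∑ : (X : Subset n) → + eIn E X ≡ ∑ E (𝟙 ∘ endsIn X)
  eIn-∑ X = countᵇ-∑ (endsIn X) E

  eIn-supermodular : (A B : Subset n) →
    + eIn E A + + eIn E B ≤ + eIn E (A ∩ B) + + eIn E (A ∪ B)
  eIn-supermodular A B = begin
    + eIn E A + + eIn E B                                  ≡⟨ cong₂ _+_ (eIn-∑ A) (eIn-∑ B) ⟩
    ∑ E (𝟙 ∘ endsIn A) + ∑ E (𝟙 ∘ endsIn B)               ≡⟨ ∑-+ E _ _ ⟨
    ∑ E (λ e → 𝟙 (endsIn A e) + 𝟙 (endsIn B e))             ≤⟨ ∑-mono-≤ E pointwise ⟩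
    ∑ E (λ e → 𝟙 (endsIn (A ∩ B) e) + 𝟙 (endsIn (A ∪ B) e)) ≡⟨ ∑-+ E _ _ ⟩
    ∑ E (𝟙 ∘ endsIn (A ∩ B)) + ∑ E (𝟙 ∘ endsIn (A ∪ B))   ≡⟨ cong₂ _+_ (eIn-∑ (A ∩ B)) (eIn-∑ (A ∪ B)) ⟨
    + eIn E (A ∩ B) + + eIn E (A ∪ B)                      ∎
    where
    open ℤ.≤-Reasoning
    pointwise : ∀ e → 𝟙 (endsIn A e) + 𝟙 (endsIn B e) ≤ 𝟙 (endsIn (A ∩ B) e) + 𝟙 (endsIn (A ∪ B) e)
    pointwise (u , w) rewrite ∈ᵇ-∩ A B u | ∈ᵇ-∩ A B w | ∈ᵇ-∪ A B u | ∈ᵇ-∪ A B w =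
      𝟙-∧-supermodular (u ∈ᵇ A) (w ∈ᵇ A) (u ∈ᵇ B) (w ∈ᵇ B)

  eIn-⁅⁆ : Loopless E → (v : Fin n) → + eIn E ⁅ v ⁆ ≡ 0ℤ
  eIn-⁅⁆ loopless v = trans (eIn-∑ ⁅ v ⁆) (∑-zeroᴬ (All.map notBoth loopless))
    where
    notBoth : ∀ {e} → proj₁ e ≢ proj₂ e → 𝟙 (endsIn ⁅ v ⁆ e) ≡ 0ℤ
    notBoth {u , w} u≢w with u ∈ᵇ ⁅ v ⁆ in u∈⁅v⁆
    ... | false = refl
    ... | true  = cong 𝟙 (trans (∈ᵇ-⁅⁆-sym w v)
                    (disjoint⇒∉ᵇ (⁅⁆-disjoint u≢w) (trans (∈ᵇ-⁅⁆-sym v u) u∈⁅v⁆)))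

  crossEdges-⋃ : {Q : List (Subset n)} → AllPairs Disjoint Q →
    + crossEdges E (⋃ Q) Q ≡ + eIn E (⋃ Q) - ∑ Q (λ A → + eIn E A)
  crossEdges-⋃ {Q} disjoint = begin
    + crossEdges E (⋃ Q) Q
      ≡⟨ countᵇ-∑ _ E ⟩
    ∑ E (λ e → 𝟙 (proj₁ e ∈ᵇ ⋃ Q ∧ proj₂ e ∈ᵇ ⋃ Q ∧ not (same e)))
      ≡⟨ ∑-cong E (λ e → 𝟙-∧-∧-not (proj₁ e ∈ᵇ ⋃ Q) (proj₂ e ∈ᵇ ⋃ Q) (same e) (both∈⋃ e)) ⟩
    ∑ E (λ e → 𝟙 (endsIn (⋃ Q) e) - 𝟙 (same e))
      ≡⟨ ∑-sub E _ _ ⟩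
    ∑ E (𝟙 ∘ endsIn (⋃ Q)) - ∑ E (𝟙 ∘ same)
      ≡⟨ cong₂ _-_ (eIn-∑ (⋃ Q)) (∑-cong E (λ e → ∑-samePart disjoint (proj₁ e) (proj₂ e))) ⟨
    + eIn E (⋃ Q) - ∑ E (λ e → ∑ Q (λ A → 𝟙 (endsIn A e)))
      ≡⟨ cong (λ s → + eIn E (⋃ Q) - s) (∑-swap E Q _) ⟩
    + eIn E (⋃ Q) - ∑ Q (λ A → ∑ E (𝟙 ∘ endsIn A))
      ≡⟨ cong (λ s → + eIn E (⋃ Q) - s) (∑-cong Q eIn-∑) ⟨
    + eIn E (⋃ Q) - ∑ Q (λ A → + eIn E A) ∎
    where
    open ≡-Reasoning
    same : Fin n × Fin n → Bool
    same e = samePart Q (proj₁ e) (proj₂ e)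
    both∈⋃ : ∀ e → same e ≡ true → endsIn (⋃ Q) e ≡ true
    both∈⋃ e same≡true with samePart⇒∈⋃ Q (proj₁ e) (proj₂ e) same≡true
    ... | u∈⋃ , w∈⋃ = cong₂ _∧_ u∈⋃ w∈⋃

  crossEdges-removeAt : (P : List (Subset n)) (i : Fin (length E)) →
    + crossEdges E ⊤ P
      ≡ 𝟙 (not (samePart P (proj₁ (lookup E i)) (proj₂ (lookup E i))))
        + + crossEdges (removeAt E i) ⊤ P
  crossEdges-removeAt P i = trans (countᵇ-removeAt _ E i)
    (cong (λ b → 𝟙 b + + crossEdges (removeAt E i) ⊤ P)
          (cong₂ (λ a b → a ∧ b ∧ not (samePart P u w)) (∈ᵇ-⊤ u) (∈ᵇ-⊤ w)))
    where
    u = proj₁ (lookup E i)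
    w = proj₂ (lookup E i)

  degree-sum : Loopless E → (S : Subset n) →
    sumOver S (λ v → + degree E v) ≡ + eIn E ⊤ + + eIn E S - + eIn E (∁ S)
  degree-sum loopless S = begin
    sumOver S (λ v → + degree E v)
      ≡⟨ ∑-cong (allFin n) (λ v → cong (λ d → if v ∈ᵇ S then d else 0ℤ) (countᵇ-∑ _ E)) ⟩
    ∑ (allFin n) (λ v → if v ∈ᵇ S then ∑ E (incident v) else 0ℤ)
      ≡⟨ ∑-cong (allFin n) (λ v → ∑-if (v ∈ᵇ S) E (incident v)) ⟩
    ∑ (allFin n) (λ v → ∑ E (λ e → if v ∈ᵇ S then incident v e else 0ℤ))
      ≡⟨ ∑-swap (allFin n) E _ ⟩
    ∑ E (λ e → ∑ (allFin n) (λ v → if v ∈ᵇ S then incident v e else 0ℤ))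
      ≡⟨ ∑-congᴬ (All.map ends∈S loopless) ⟩
    ∑ E (λ e → 𝟙 (proj₁ e ∈ᵇ S) + 𝟙 (proj₂ e ∈ᵇ S))
      ≡⟨ ∑-cong E count-ends ⟩
    ∑ E (λ e → 𝟙 (endsIn ⊤ e) + 𝟙 (endsIn S e) - 𝟙 (endsIn (∁ S) e))
      ≡⟨ trans (∑-sub E _ _) (cong (λ s → s - ∑ E (𝟙 ∘ endsIn (∁ S))) (∑-+ E _ _)) ⟩
    ∑ E (𝟙 ∘ endsIn ⊤) + ∑ E (𝟙 ∘ endsIn S) - ∑ E (𝟙 ∘ endsIn (∁ S))
      ≡⟨ cong₂ _-_ (cong₂ _+_ (eIn-∑ ⊤) (eIn-∑ S)) (eIn-∑ (∁ S)) ⟨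
    + eIn E ⊤ + + eIn E S - + eIn E (∁ S) ∎
    where
    open ≡-Reasoning
    incident : Fin n → Fin n × Fin n → ℤ
    incident v e = 𝟙 (proj₁ e ∈ᵇ ⁅ v ⁆ ∨ proj₂ e ∈ᵇ ⁅ v ⁆)
    if-𝟙-comm : ∀ b c → (if b then 𝟙 c else 0ℤ) ≡ (if c then 𝟙 b else 0ℤ)
    if-𝟙-comm true  true  = refl
    if-𝟙-comm true  false = refl
    if-𝟙-comm false true  = refl
    if-𝟙-comm false false = refl
    ends∈S : ∀ {e} → proj₁ e ≢ proj₂ e →
      ∑ (allFin n) (λ v → if v ∈ᵇ S then incident v e else 0ℤ) ≡ 𝟙 (proj₁ e ∈ᵇ S) + 𝟙 (proj₂ e ∈ᵇ S)
    ends∈S {u , w} u≢w = begin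
      ∑ (allFin n) (λ v → if v ∈ᵇ S then incident v (u , w) else 0ℤ)
        ≡⟨ ∑-cong (allFin n) pointwise ⟩
      sumOver (⁅ u ⁆ ∪ ⁅ w ⁆) (λ v → 𝟙 (v ∈ᵇ S))
        ≡⟨ sumOver-∪ _ (⁅⁆-disjoint u≢w) ⟩
      sumOver ⁅ u ⁆ (λ v → 𝟙 (v ∈ᵇ S)) + sumOver ⁅ w ⁆ (λ v → 𝟙 (v ∈ᵇ S))
        ≡⟨ cong₂ _+_ (sumOver-⁅⁆ u _) (sumOver-⁅⁆ w _) ⟩
      𝟙 (u ∈ᵇ S) + 𝟙 (w ∈ᵇ S) ∎
      where
      pointwise : ∀ v → (if v ∈ᵇ S then incident v (u , w) else 0ℤ)
                      ≡ (if v ∈ᵇ (⁅ u ⁆ ∪ ⁅ w ⁆) then 𝟙 (v ∈ᵇ S) else 0ℤ)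
      pointwise v rewrite ∈ᵇ-∪ ⁅ u ⁆ ⁅ w ⁆ v | ∈ᵇ-⁅⁆-sym u v | ∈ᵇ-⁅⁆-sym w v =
        if-𝟙-comm (v ∈ᵇ S) _
    count-ends : ∀ e → 𝟙 (proj₁ e ∈ᵇ S) + 𝟙 (proj₂ e ∈ᵇ S)
                     ≡ 𝟙 (endsIn ⊤ e) + 𝟙 (endsIn S e) - 𝟙 (endsIn (∁ S) e)
    count-ends (u , w) rewrite ∈ᵇ-⊤ u | ∈ᵇ-⊤ w | ∈ᵇ-∁ S u | ∈ᵇ-∁ S w with u ∈ᵇ S | w ∈ᵇ S
    ... | true  | true  = refl
    ... | true  | false = refl
    ... | false | true  = refl
    ... | false | false = refl

≤-via-difference : ∀ {a b c d : ℤ} → b - a ≡ d - c → a ≤ b → c ≤ d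
≤-via-difference b-a≡d-c a≤b = ℤ.0≤i-j⇒j≤i (subst (0ℤ ≤_) b-a≡d-c (ℤ.i≤j⇒0≤j-i a≤b))

<-via-difference : ∀ {a b c d : ℤ} → b - a ≡ d - c → a < b → c < d
<-via-difference {a} {b} {c} {d} b-a≡d-c a<b =
  ℤ.suc[i]≤j⇒i<j (≤-via-difference shifted (ℤ.i<j⇒suc[i]≤j a<b))
  where
  shift : ∀ x y → x - (1ℤ + y) ≡ x - y - 1ℤ
  shift = solve-∀
  shifted : b - (1ℤ + a) ≡ d - (1ℤ + c)
  shifted = trans (shift b a) (trans (cong (λ z → z - 1ℤ) b-a≡d-c) (sym (shift d c)))

module Excess {n : ℕ} (E : Edges n) (l : SetFn n) where

  pointSum : Subset n → ℤ
  pointSum X = sumOver X (λ v → l ⁅ v ⁆)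

  excess : Subset n → ℤ
  excess X = pointSum X - l X - + eIn E X

  partition-slack : ∀ {Y Q} → IsPartition Y Q →
    + crossEdges E Y Q - (sumL l Q - l Y) ≡ ∑ Q excess - excess Y
  partition-slack {Q = Q} (_ , disjoint , refl) = sym (begin
    ∑ Q excess - excess (⋃ Q)
      ≡⟨ cong (λ s → s - excess (⋃ Q)) (trans (∑-sub Q _ _) (cong (λ s → s - ∑ Q e) (∑-sub Q _ _))) ⟩
    ∑ Q pointSum - ∑ Q l - ∑ Q e - excess (⋃ Q)
      ≡⟨ cong (λ s → s - ∑ Q l - ∑ Q e - excess (⋃ Q)) (sumOver-⋃ _ disjoint) ⟩
    pointSum (⋃ Q) - ∑ Q l - ∑ Q e - excess (⋃ Q)
      ≡⟨ rearrange (pointSum (⋃ Q)) (∑ Q l) (∑ Q e) (l (⋃ Q)) (e (⋃ Q)) ⟩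
    e (⋃ Q) - ∑ Q e - (∑ Q l - l (⋃ Q))
      ≡⟨ cong (λ c → c - (sumL l Q - l (⋃ Q))) (crossEdges-⋃ E disjoint) ⟨
    + crossEdges E (⋃ Q) Q - (sumL l Q - l (⋃ Q)) ∎)
    where
    open ≡-Reasoning
    e : Subset n → ℤ
    e A = + eIn E A
    rearrange : ∀ p L ε lY eY → p - L - ε - (p - lY - eY) ≡ eY - ε - (L - lY)
    rearrange = solve-∀

  cut⇒excess≤ : ∀ {Y Q} → IsPartition Y Q → sumL l Q - l Y ≤ + crossEdges E Y Q → excess Y ≤ ∑ Q excess
  cut⇒excess≤ isPartition = ≤-via-difference (partition-slack isPartition)

  excess<⇒cut< : ∀ {Y Q} → IsPartition Y Q → excess Y < ∑ Q excess → sumL l Q - l Y < + crossEdges E Y Q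
  excess<⇒cut< isPartition = <-via-difference (sym (partition-slack isPartition))

  excess-⁅⁆ : Loopless E → ∀ v → excess ⁅ v ⁆ ≡ 0ℤ
  excess-⁅⁆ loopless v =
    trans (cong₂ (λ p e → p - l ⁅ v ⁆ - e) (sumOver-⁅⁆ v _) (eIn-⁅⁆ E loopless v)) (cancel (l ⁅ v ⁆))
    where cancel : ∀ a → a - a - 0ℤ ≡ 0ℤ
          cancel = solve-∀

  ∑-excess-singletons : Loopless E → ∀ Y → ∑ (singletons Y) excess ≡ 0ℤ
  ∑-excess-singletons loopless Y =
    ∑-zeroᴬ {f = excess} (All.map⁺ (All.universal (excess-⁅⁆ loopless) (filter (_∈? Y) (allFin n))))

  partitionConnected⇒excess≤0 : Loopless E → ∀ {Y} → PartitionConnected l E Y → excess Y ≤ 0ℤ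
  partitionConnected⇒excess≤0 loopless {Y} connected =
    subst (excess Y ≤_) (∑-excess-singletons loopless Y) (cut⇒excess≤ isPartition (connected _ isPartition))
    where isPartition = singletons-isPartition Y

  edgeless⇒0≤excess : WeaklySubadditive l → ∀ X → eIn E X ≡ 0 → 0ℤ ≤ excess X
  edgeless⇒0≤excess subadditive X noEdges rewrite noEdges =
    subst (0ℤ ≤_) (sym (ℤ.+-identityʳ _)) (ℤ.i≤j⇒0≤j-i (subadditive X))

  excess-intersectingSubmodular : IntersectingSupermodular l → IntersectingSubmodular excess
  excess-intersectingSubmodular supermodular A B A∩B≠∅ =
    ℤ.0≤i-j⇒j≤i (subst (0ℤ ≤_) slack≡
      (ℤ.+-mono-≤ (ℤ.i≤j⇒0≤j-i (supermodular A B A∩B≠∅)) (ℤ.i≤j⇒0≤j-i (eIn-supermodular E A B))))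
    where
    open ≡-Reasoning
    p = pointSum
    e : Subset n → ℤ
    e X = + eIn E X
    lSlack = l (A ∩ B) + l (A ∪ B) - (l A + l B)
    eSlack = e (A ∩ B) + e (A ∪ B) - (e A + e B)
    rearrange : ∀ pA pB pI pU lA lB lI lU eA eB eI eU →
      pA - lA - eA + (pB - lB - eB) - (pI - lI - eI + (pU - lU - eU))
        ≡ lI + lU - (lA + lB) + (eI + eU - (eA + eB)) - (pI + pU - (pA + pB))
    rearrange = solve-∀
    slack≡ : lSlack + eSlack ≡ excess A + excess B - (excess (A ∩ B) + excess (A ∪ B))
    slack≡ = sym (begin
      excess A + excess B - (excess (A ∩ B) + excess (A ∪ B))
        ≡⟨ rearrange (p A) (p B) (p (A ∩ B)) (p (A ∪ B)) (l A) (l B) (l (A ∩ B)) (l (A ∪ B))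
                     (e A) (e B) (e (A ∩ B)) (e (A ∪ B)) ⟩
      lSlack + eSlack - (p (A ∩ B) + p (A ∪ B) - (p A + p B))
        ≡⟨ cong (λ z → lSlack + eSlack - z) (ℤ.i≡j⇒i-j≡0 (sumOver-modular A B _)) ⟩
      lSlack + eSlack - 0ℤ
        ≡⟨ ℤ.+-identityʳ _ ⟩
      lSlack + eSlack ∎)

  separating-cut< :
    IntersectingSupermodular l → PartitionConnected l E ⊤ →
    ∀ X → (∀ Y → ∣ Y ∣ ℕ.< ∣ X ∣ → 0ℤ ≤ excess Y) → excess X < 0ℤ →
    ∀ {u w} → u ∈ᵇ X ≡ true → w ∈ᵇ X ≡ true →
    ∀ P → IsPartition ⊤ P → samePart P u w ≡ false → sumL l P - l ⊤ < + crossEdges E ⊤ P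
  separating-cut< supermodular connected X 0≤excess[⊂X] excess[X]<0 {u} {w} u∈X w∈X
                  P isPartition separated =
    excess<⇒cut< isPartition (begin-strict
      excess ⊤               ≤⟨ cut⇒excess≤ isPartition′ (connected P′ isPartition′) ⟩
      ∑ P′ excess            ≤⟨ absorb-∑-≤ (excess-intersectingSubmodular supermodular) X P
                                  0≤excess[X∩A] (proj₁ (proj₂ isPartition)) ⟩
      excess X + ∑ P excess  <⟨ ℤ.+-monoˡ-< (∑ P excess) excess[X]<0 ⟩
      0ℤ + ∑ P excess        ≡⟨ ℤ.+-identityˡ (∑ P excess) ⟩
      ∑ P excess             ∎)
    where
    open ℤ.≤-Reasoning
    P′ = absorb X P
    isPartition′ : IsPartition ⊤ P′
    isPartition′ = subst (λ Y → IsPartition Y P′) (∪-zeroʳ X)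
                     (absorb-isPartition (u , ∈ᵇ⇒∈ u∈X) isPartition)
    0≤excess[X∩A] : All (λ A → 0ℤ ≤ excess (X ∩ A)) P
    0≤excess[X∩A] = All.map (λ {A} → proper A) (samePart≡false P u w separated)
      where
      proper : ∀ A → (u ∈ᵇ A ∧ w ∈ᵇ A) ≡ false → 0ℤ ≤ excess (X ∩ A)
      proper A u,w∉A with u ∈ᵇ A in u∈A
      ... | false = 0≤excess[⊂X] (X ∩ A) (∣p∩q∣<∣p∣ {X = X} {A} u∈X u∈A)
      ... | true  = 0≤excess[⊂X] (X ∩ A) (∣p∩q∣<∣p∣ {X = X} {A} w∈X u,w∉A)

  removeAt-partitionConnected :
    IntersectingSupermodular l → PartitionConnected l E ⊤ →
    ∀ X → (∀ Y → ∣ Y ∣ ℕ.< ∣ X ∣ → 0ℤ ≤ excess Y) → excess X < 0ℤ →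
    ∀ i → endsIn X (lookup E i) ≡ true → PartitionConnected l (removeAt E i) ⊤
  removeAt-partitionConnected supermodular connected X 0≤excess[⊂X] excess[X]<0 i ends∈X P isPartition
    with samePart P (proj₁ (lookup E i)) (proj₂ (lookup E i)) in same | crossEdges-removeAt E P i
  ... | true  | cross≡ = subst (sumL l P - l ⊤ ≤_) cross≡ (connected P isPartition)
  ... | false | cross≡ =
    subst (sumL l P - l ⊤ ≤_) (ℤ.pred-suc _) (ℤ.i<j⇒i≤pred[j] (subst (sumL l P - l ⊤ <_) cross≡ demand<cross))
    where
    demand<cross : sumL l P - l ⊤ < + crossEdges E ⊤ P
    demand<cross = separating-cut< supermodular connected X 0≤excess[⊂X] excess[X]<0
                     (∧-conicalˡ _ _ ends∈X) (∧-conicalʳ _ _ ends∈X) P isPartition same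

  minimal⇒0≤excess : IntersectingSupermodular l → WeaklySubadditive l →
    MinimallyPartitionConnected l E → ∀ X → 0ℤ ≤ excess X
  minimal⇒0≤excess supermodular subadditive (connected , minimal) X = <-rec Claim step ∣ X ∣ X refl
    where
    Claim : ℕ → Set
    Claim k = ∀ X → ∣ X ∣ ≡ k → 0ℤ ≤ excess X
    not-negative : ∀ X → (∀ Y → ∣ Y ∣ ℕ.< ∣ X ∣ → 0ℤ ≤ excess Y) → ¬ excess X < 0ℤ
    not-negative X 0≤excess[⊂X] excess[X]<0 with countᵇ≡0⊎∃ (endsIn X) E
    ... | inj₁ edgeless    = ℤ.<⇒≱ excess[X]<0 (edgeless⇒0≤excess subadditive X edgeless)
    ... | inj₂ (i , ends∈X) =
      minimal i (removeAt-partitionConnected supermodular connected X 0≤excess[⊂X] excess[X]<0 i ends∈X)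
    step : ∀ k → (∀ {j} → j ℕ.< k → Claim j) → Claim k
    step k IH X refl with 0ℤ ℤ.≤? excess X
    ... | yes 0≤excess = 0≤excess
    ... | no  excess≱0 = ⊥-elim (not-negative X (λ Y ∣Y∣<∣X∣ → IH ∣Y∣<∣X∣ Y refl) (ℤ.≰⇒> excess≱0))

  excess≡0⇒l≡ : ∀ {X} → excess X ≡ 0ℤ → l X ≡ pointSum X - + eIn E X
  excess≡0⇒l≡ {X} tight = begin
    l X                                   ≡⟨ solveFor (pointSum X) (l X) (+ eIn E X) ⟩
    pointSum X - + eIn E X - excess X     ≡⟨ cong (λ h → pointSum X - + eIn E X - h) tight ⟩
    pointSum X - + eIn E X - 0ℤ           ≡⟨ ℤ.+-identityʳ _ ⟩
    pointSum X - + eIn E X                ∎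
    where
    open ≡-Reasoning
    solveFor : ∀ p λ′ ε → λ′ ≡ p - ε - (p - λ′ - ε)
    solveFor = solve-∀

  Θ-tight : ∀ {Y P} → IsPartition Y P → All (λ A → excess A ≡ 0ℤ) P → Θ l E Y P ≡ pointSum Y - + eIn E Y
  Θ-tight {Y} {P} isPartition tight = begin
    sumL l P - + crossEdges E Y P                    ≡⟨ rearrange (sumL l P) (+ crossEdges E Y P) (l Y) ⟩
    l Y - (+ crossEdges E Y P - (sumL l P - l Y))    ≡⟨ cong (λ s → l Y - s) (partition-slack isPartition) ⟩
    l Y - (∑ P excess - excess Y)                    ≡⟨ cong (λ s → l Y - (s - excess Y)) (∑-zeroᴬ tight) ⟩
    l Y - (0ℤ - excess Y)                            ≡⟨ unfold (pointSum Y) (l Y) (+ eIn E Y) ⟩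
    pointSum Y - + eIn E Y                           ∎
    where
    open ≡-Reasoning
    rearrange : ∀ L c λ′ → L - c ≡ λ′ - (c - (L - λ′))
    rearrange = solve-∀
    unfold : ∀ p λ′ ε → λ′ - (0ℤ - (p - λ′ - ε)) ≡ p - ε
    unfold = solve-∀

mainTheorem19 : (n : ℕ) (E : Edges n) → Loopless E →
    (l : Subset n → ℤ) → l ⊥ ≡ + 0 →
    IntersectingSupermodular l → WeaklySubadditive l →
    MinimallyPartitionConnected l E →
    (S : Subset n) (P : List (Subset n)) →
    IsComponentPartition l E (∁ S) P →
    Θ l E (∁ S) P
      ≡ sumOver S (λ v → + degree E v - l ⁅ v ⁆) + l ⊤ - + eIn E S
mainTheorem19 _ E loopless l _ supermodular subadditive minimal S P (isPartition , components) = begin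
  Θ l E (∁ S) P
    ≡⟨ Θ-tight isPartition (All.map (tight ∘ proj₁) components) ⟩
  pointSum (∁ S) - + eIn E (∁ S)
    ≡⟨ rearrange (pointSum S) (pointSum (∁ S)) (+ eIn E ⊤) (+ eIn E S) (+ eIn E (∁ S)) ⟩
  + eIn E ⊤ + + eIn E S - + eIn E (∁ S) - pointSum S
    + (pointSum S + pointSum (∁ S) - + eIn E ⊤) - + eIn E S
    ≡⟨ cong₂ (λ d λ⊤ → d - pointSum S + λ⊤ - + eIn E S) (degree-sum E loopless S) l⊤ ⟨
  sumOver S (λ v → + degree E v) - pointSum S + l ⊤ - + eIn E S
    ≡⟨ cong (λ s → s + l ⊤ - + eIn E S) (sumOver-sub S _ _) ⟨
  sumOver S (λ v → + degree E v - l ⁅ v ⁆) + l ⊤ - + eIn E S ∎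
  where
  open ≡-Reasoning
  open Excess E l
  tight : ∀ {A} → PartitionConnected l E A → excess A ≡ 0ℤ
  tight connected = ℤ.≤-antisym (partitionConnected⇒excess≤0 loopless connected)
                                (minimal⇒0≤excess supermodular subadditive minimal _)
  l⊤ : l ⊤ ≡ pointSum S + pointSum (∁ S) - + eIn E ⊤
  l⊤ = trans (excess≡0⇒l≡ (tight (proj₁ minimal))) (cong (λ p → p - + eIn E ⊤) (sumOver-∁ S _))
  rearrange : ∀ p p∁ e⊤ eS e∁ → p∁ - e∁ ≡ e⊤ + eS - e∁ - p + (p + p∁ - e⊤) - eS
  rearrange = solve-∀
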